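{- Suppose $\mathbf{V}$ is co-divisible and $d_V$ is its symmetric distance. Let $(a_i)_{i\in I}$ be a family in $\mathbf{V}$, $D$ an ultrafilter on $I$, and $b\in\mathbf{V}$ with $\lim_{i,D}a_i\le b$ and $0\prec b\mathbin{\dot{ - }}\lim_{i,D}a_i$. Then there is $A\in D$ such that $a_i\le b$ for all $i\in A$.
   Context: $\mathbf{V}$ is a value co-quantale and $\mathbf{V}$-domain, $a\mathbin{\dot{ - }} b:=\bigwedge\{r: r+b\ge a\}$, $\prec$ is the co-well-below relation ($x\prec y$ iff every $A$ with $\bigwedge A\le x$ has some $a\le y$), co-divisible means $a\le b\Rightarrow b=a+c$ for some $c$, $d_V(p,q)=(p\mathbin{\dot{ - }} q)\vee(q\mathbin{\dot{ - }} p)$, and $\lim_{i,D}a_i$ is the unique $a$ with $\{i:d_V(a,a_i)\le\epsilon\}\in D$ for all $\epsilon$ with $0\prec\epsilon$. -}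

module Defs where

open import Data.Product using (Σ; _×_; _,_)
open import Data.Sum using (_⊎_)
open import Data.Empty using (⊥)
open import Data.Unit using () renaming (⊤ to Unit)
open import Relation.Nullary using (¬_)
open import Relation.Binary.PropositionalEquality using (_≡_)

Pred : Set → Set₁
Pred A = A → Set

record CompleteLattice : Set₁ where
  field
    Carrier : Set
    _≤_     : Carrier → Carrier → Set
    ≤-refl  : ∀ {x} → x ≤ x
    ≤-trans : ∀ {x y z} → x ≤ y → y ≤ z → x ≤ z
    ≤-antisym : ∀ {x y} → x ≤ y → y ≤ x → x ≡ y
    ⋀       : Pred Carrier → Carrier
    ⋀-lower : ∀ (S : Pred Carrier) {s} → S s → ⋀ S ≤ s
    ⋀-greatest : ∀ (S : Pred Carrier) {x} → (∀ {s} → S s → x ≤ s) → x ≤ ⋀ S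

  ⊤ : Carrier
  ⊤ = ⋀ (λ _ → ⊥)

  _∧_ : Carrier → Carrier → Carrier
  x ∧ y = ⋀ (λ u → (u ≡ x) ⊎ (u ≡ y))

  _∨_ : Carrier → Carrier → Carrier
  x ∨ y = ⋀ (λ u → (x ≤ u) × (y ≤ u))

  _≺_ : Carrier → Carrier → Set₁
  x ≺ y = ∀ (A : Pred Carrier) → ⋀ A ≤ x → Σ Carrier (λ a → A a × (a ≤ y))

-- Value co-quantales (dual of Flagg's value quantales)

record ValueCoQuantale : Set₁ where
  field
    lattice : CompleteLattice
  open CompleteLattice lattice public
  field
    _+_     : Carrier → Carrier → Carrier
    0#      : Carrier
    +-assoc : ∀ x y z → (x + y) + z ≡ x + (y + z)
    +-comm  : ∀ x y → x + y ≡ y + x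
    +-identityˡ : ∀ x → 0# + x ≡ x
    0-bottom : ∀ x → 0# ≤ x
    +-⋀ : ∀ a (S : Pred Carrier) →
          a + ⋀ S ≡ ⋀ (λ x → Σ Carrier (λ s → S s × (x ≡ a + s)))
    0≺⊤ : 0# ≺ ⊤
    0≺-∧ : ∀ {a b} → 0# ≺ a → 0# ≺ b → 0# ≺ (a ∧ b)

  _∸_ : Carrier → Carrier → Carrier
  a ∸ b = ⋀ (λ r → a ≤ (r + b))

  dV : Carrier → Carrier → Carrier
  dV p q = (p ∸ q) ∨ (q ∸ p)

  CoDivisible : Set
  CoDivisible = ∀ {a b} → a ≤ b → Σ Carrier (λ c → b ≡ a + c)

-- V-domain: every element is the meet of the elements co-well-above it
-- (complete distributivity / continuity for the co-well-below relation):
-- a = ⋀ { b : a ≺ b }, written out as "a is the greatest lower bound of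
-- { b : a ≺ b }" (the set lives in Set₁, so ⋀ cannot be applied directly).
IsVDomain : ValueCoQuantale → Set₁
IsVDomain V = ∀ a → (∀ b → a ≺ b → a ≤ b) × (∀ x → (∀ b → a ≺ b → x ≤ b) → x ≤ a)
  where open ValueCoQuantale V

record Ultrafilter (I : Set) : Set₁ where
  field
    _∈_ : Pred I → Set
    whole    : _∈_ (λ _ → Unit)
    no-empty : ¬ (_∈_ (λ _ → ⊥))
    up-closed : ∀ {A B : Pred I} → _∈_ A → (∀ {i} → A i → B i) → _∈_ B
    ∩-closed : ∀ {A B : Pred I} → _∈_ A → _∈_ B → _∈_ (λ i → A i × B i)
    ultra    : ∀ (A : Pred I) → (_∈_ A) ⊎ (_∈_ (λ i → ¬ A i))

module _ (V : ValueCoQuantale) where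
  open ValueCoQuantale V

  IsDLimit : {I : Set} → Ultrafilter I → (I → Carrier) → Carrier → Set₁
  IsDLimit D as a = ∀ ε → 0# ≺ ε → Ultrafilter._∈_ D (λ i → dV a (as i) ≤ ε)

-- On the set of indices where d_V(lim, aᵢ) ≤ b ∸ lim, which lies in D by the
-- definition of the limit, we get aᵢ ≤ (aᵢ ∸ lim) + lim ≤ (b ∸ lim) + lim, and
-- co-divisibility (b = lim + c) makes the last sum at most c + lim = b.
module Submission where

open import Defs
open import Data.Product using (Σ; _×_; _,_; proj₂)
open import Data.Sum using (_⊎_; inj₁; inj₂)
open import Relation.Binary.PropositionalEquality using (_≡_; refl; sym; subst; subst₂)

module ValueCoQuantaleProperties (V : ValueCoQuantale) where
  open ValueCoQuantale V

  ≤⇒≡∧ : ∀ {x y} → x ≤ y → x ≡ x ∧ y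
  ≤⇒≡∧ {x} {y} x≤y = ≤-antisym (⋀-greatest _ lower) (⋀-lower _ (inj₁ refl))
    where
      lower : ∀ {s} → (s ≡ x) ⊎ (s ≡ y) → x ≤ s
      lower (inj₁ refl) = ≤-refl
      lower (inj₂ refl) = x≤y

  -- Addition preserves binary meets (an instance of +-⋀), hence order.
  +-monoʳ-≤ : ∀ z {x y} → x ≤ y → (z + x) ≤ (z + y)
  +-monoʳ-≤ z {x} {y} x≤y =
    subst (λ t → (z + t) ≤ (z + y)) (sym (≤⇒≡∧ x≤y))
      (subst (_≤ (z + y)) (sym (+-⋀ z _)) (⋀-lower _ (y , inj₂ refl , refl)))

  +-monoˡ-≤ : ∀ z {x y} → x ≤ y → (x + z) ≤ (y + z)
  +-monoˡ-≤ z {x} {y} x≤y =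
    subst₂ _≤_ (+-comm z x) (+-comm z y) (+-monoʳ-≤ z x≤y)

  ∸-least : ∀ {a b r} → a ≤ (r + b) → (a ∸ b) ≤ r
  ∸-least = ⋀-lower _

  ≤-∸-+ : ∀ a b → a ≤ ((a ∸ b) + b)
  ≤-∸-+ a b = subst (a ≤_) (+-comm b (a ∸ b))
    (subst (a ≤_) (sym (+-⋀ b _)) (⋀-greatest _ bound))
    where
      bound : ∀ {w} → Σ Carrier (λ s → (a ≤ (s + b)) × (w ≡ b + s)) → a ≤ w
      bound (s , a≤s+b , refl) = subst (a ≤_) (+-comm s b) a≤s+b

  y≤x∨y : ∀ x y → y ≤ (x ∨ y)
  y≤x∨y x y = ⋀-greatest _ proj₂

  ∸≤dV : ∀ p q → (q ∸ p) ≤ dV p q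
  ∸≤dV p q = y≤x∨y (p ∸ q) (q ∸ p)

  ∸-+-≤ : CoDivisible → ∀ {a b} → a ≤ b → ((b ∸ a) + a) ≤ b
  ∸-+-≤ codiv {a} {b} a≤b with codiv a≤b
  ... | c , refl =
    subst (((b ∸ a) + a) ≤_) (+-comm c a)
      (+-monoˡ-≤ a (∸-least (subst (_≤ (c + a)) (+-comm c a) ≤-refl)))

  ≤-of-∸≤∸ : CoDivisible → ∀ {x a b} → a ≤ b → (x ∸ a) ≤ (b ∸ a) → x ≤ b
  ≤-of-∸≤∸ codiv {x} {a} {b} a≤b x∸a≤b∸a =
    ≤-trans (≤-∸-+ x a) (≤-trans (+-monoˡ-≤ a x∸a≤b∸a) (∸-+-≤ codiv a≤b))

mainTheorem12 : (V : ValueCoQuantale) → IsVDomain V →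
    ValueCoQuantale.CoDivisible V →
    {I : Set} (D : Ultrafilter I) (a : I → ValueCoQuantale.Carrier V)
    (lim b : ValueCoQuantale.Carrier V) →
    IsDLimit V D a lim →
    ValueCoQuantale._≤_ V lim b →
    ValueCoQuantale._≺_ V (ValueCoQuantale.0# V) (ValueCoQuantale._∸_ V b lim) →
    Σ (I → Set) (λ A → Ultrafilter._∈_ D A × (∀ i → A i → ValueCoQuantale._≤_ V (a i) b))
mainTheorem12 V _ codiv D a lim b isLim lim≤b 0≺b∸lim =
  (λ i → dV lim (a i) ≤ (b ∸ lim)) , isLim (b ∸ lim) 0≺b∸lim , below
  where
    open ValueCoQuantale V
    open ValueCoQuantaleProperties V

    below : ∀ i → dV lim (a i) ≤ (b ∸ lim) → a i ≤ b
    below i close = ≤-of-∸≤∸ codiv lim≤b (≤-trans (∸≤dV lim (a i)) close)
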